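{- Let $R$ be the region of the hexagonal grid $H$ consisting of one hexagon together with its six adjacent hexagons (the $2\times2\times2$ hexagonal region). Then $R$ has a signed tiling using only bones and snakes, and $M(R,v) = I$ (the $2\times 2$ identity matrix) for any vertex $v$ on the boundary of $R$.
   Context: Let $H$ be the regular hexagonal tiling of the plane, drawn so that every hexagon has a horizontal top edge and a horizontal bottom edge. Orient and label the edges: each southwest–northeast edge is oriented northeast and labeled $\alpha$; each southeast–northwest edge is oriented northwest and labeled $\beta$; each horizontal edge is oriented westward and labeled $\gamma$. Let $\omega$ be a primitive cube root of unity and set $\alpha = \begin{bmatrix}\omega^7 & 0\\ 0 & \omega^5\end{bmatrix}$, $\beta = \begin{bmatrix}\omega^7 & \omega^3\\ 0 & \omega^5\end{bmatrix}$, $\gamma = \begin{bmatrix}\omega^5 & 0\\ \omega^3 & \omega^7\end{bmatrix}$. Traversing an edge along its orientation contributes its matrix; against it, the inverse. For a region $R$ (finite simply connected union of hexagons with a single closed boundary loop) and a boundary vertex $v$, traverse the boundary once counterclockwise from $v$ back to $v$, meeting edges with contributed matrices $M_1,\dots,M_n$ in order, and set $M(R,v)=M_n\cdots M_1$. Two hexagons are adjacent if they share an edge. Identify hexagons with their centers; let $u,w$ denote vectors from a hexagon center to an adjacent hexagon center. A bone is three hexagons with centers $p,p+u,p+2u$; a snake is four hexagons with centers $p,p+u,p+u+w,p+2u+w$ with $u,w$ at angle $60^\circ$. A signed tiling of $R$ is a finite collection of tiles, each with weight $+1$ or $-1$, such that for every hexagon $h$ of $H$ the sum of the weights of the tiles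 containing $h$ is $1$ if $h\subseteq R$ and $0$ otherwise. -}

module Defs where

open import Data.Nat using (ℕ; zero; suc)
open import Data.Integer using (ℤ; +_; -_; _+_; _-_; _*_; 0ℤ; 1ℤ)
import Data.Integer.Properties as ℤP
open import Data.Fin using (Fin; zero; suc)
open import Data.Product using (Σ; _×_; _,_; proj₁; proj₂; ∃)
import Data.Product.Properties as ×P
open import Data.List using (List; []; _∷_; foldr; foldl; map; sum)
open import Data.List.Membership.Propositional using (_∈_; _∉_)
open import Data.List.Relation.Unary.All using (All)
open import Data.List.Relation.Unary.Unique.Propositional using (Unique)
open import Data.Sign using (Sign)
open import Relation.Binary.PropositionalEquality using (_≡_)
open import Relation.Nullary using (yes; no)
open import Data.Sum using (_⊎_)

-- The ring ℤ[ζ] generated by a primitive 12th root of unity ζ (written ω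
-- below): ℤ[x]/(x⁴ - x² + 1), the 12th cyclotomic polynomial.
-- mkE a b c d  represents  a + bω + cω² + dω³.  Since ℤ[x]/Φ₁₂ embeds into ℂ
-- via x ↦ any primitive 12th root of unity, products and equalities computed
-- here agree with those of the corresponding complex matrices.

record ℤω : Set where
  constructor mkE
  field
    c0 c1 c2 c3 : ℤ

infixl 6 _+ω_
infixl 7 _*ω_

_+ω_ : ℤω → ℤω → ℤω
mkE a0 a1 a2 a3 +ω mkE b0 b1 b2 b3 = mkE (a0 + b0) (a1 + b1) (a2 + b2) (a3 + b3)

-- product of polynomials (degree ≤ 6), reduced with
-- x⁴ = x² - 1,  x⁵ = x³ - x,  x⁶ = -1
_*ω_ : ℤω → ℤω → ℤω
mkE a0 a1 a2 a3 *ω mkE b0 b1 b2 b3 =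
  mkE (p0 - p4 - p6) (p1 - p5) (p2 + p4) (p3 + p5)
  where
  p0 = a0 * b0
  p1 = a0 * b1 + a1 * b0
  p2 = a0 * b2 + a1 * b1 + a2 * b0
  p3 = a0 * b3 + a1 * b2 + a2 * b1 + a3 * b0
  p4 = a1 * b3 + a2 * b2 + a3 * b1
  p5 = a2 * b3 + a3 * b2
  p6 = a3 * b3

negω : ℤω → ℤω
negω (mkE a b c d) = mkE (- a) (- b) (- c) (- d)

0ω 1ω ω : ℤω
0ω = mkE 0ℤ 0ℤ 0ℤ 0ℤ
1ω = mkE 1ℤ 0ℤ 0ℤ 0ℤ
ω  = mkE 0ℤ 1ℤ 0ℤ 0ℤ

ω^ : ℕ → ℤω
ω^ zero    = 1ω
ω^ (suc n) = ω *ω ω^ n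

record Mat : Set where
  constructor mat
  field
    a11 a12 a21 a22 : ℤω

infixl 7 _·_
_·_ : Mat → Mat → Mat
mat a b c d · mat e f g h =
  mat (a *ω e +ω b *ω g) (a *ω f +ω b *ω h)
      (c *ω e +ω d *ω g) (c *ω f +ω d *ω h)

I₂ : Mat
I₂ = mat 1ω 0ω 0ω 1ω

-- Inverse of a matrix of determinant 1 (its adjugate).  The three edge
-- matrices α, β, γ all have determinant ω^12 = 1, so this is their inverse.
inv₁ : Mat → Mat
inv₁ (mat a b c d) = mat d (negω b) (negω c) a

αM βM γM : Mat
αM = mat (ω^ 7) 0ω (0ω) (ω^ 5)
βM = mat (ω^ 7) (ω^ 3) 0ω (ω^ 5)
γM = mat (ω^ 5) 0ω (ω^ 3) (ω^ 7)

-- Flat-topped hexagons of side s.  A point (x , y) of the plane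
-- is given by integers (X , Y) with x = X·s/2 and y = Y·s·√3/2.
-- Hexagon vertices relative to the centre: (±2,0), (±1,±1).

Point : Set
Point = ℤ × ℤ

Hex : Set
Hex = ℤ × ℤ

Vertex : Set
Vertex = Point

_⊕_ : ℤ × ℤ → ℤ × ℤ → ℤ × ℤ
(a , b) ⊕ (c , d) = (a + c , b + d)

centre : Hex → Point
centre (a , b) = (+ 3 * a , a + + 2 * b)

-- the six vectors from a hexagon to its adjacent hexagons, in
-- counterclockwise cyclic order (consecutive ones at angle 60°):
-- NE, N, NW, SW, S, SE
unit : Fin 6 → Hex
unit zero                               = (+ 1 , + 0)
unit (suc zero)                         = (+ 0 , + 1)
unit (suc (suc zero))                   = (- + 1 , + 1)
unit (suc (suc (suc zero)))             = (- + 1 , + 0)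
unit (suc (suc (suc (suc zero))))       = (+ 0 , - + 1)
unit (suc (suc (suc (suc (suc zero))))) = (+ 1 , - + 1)

rotL rotR : Fin 6 → Fin 6
rotL zero                               = suc zero
rotL (suc zero)                         = suc (suc zero)
rotL (suc (suc zero))                   = suc (suc (suc zero))
rotL (suc (suc (suc zero)))             = suc (suc (suc (suc zero)))
rotL (suc (suc (suc (suc zero))))       = suc (suc (suc (suc (suc zero))))
rotL (suc (suc (suc (suc (suc zero))))) = zero
rotR zero                               = suc (suc (suc (suc (suc zero))))
rotR (suc zero)                         = zero
rotR (suc (suc zero))                   = suc zero
rotR (suc (suc (suc zero)))             = suc (suc zero)
rotR (suc (suc (suc (suc zero))))       = suc (suc (suc zero))
rotR (suc (suc (suc (suc (suc zero))))) = suc (suc (suc (suc zero)))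

data Step : Set where
  NE SW NW SE W E : Step

stepVec : Step → Point
stepVec NE = (+ 1 , + 1)
stepVec SW = (- + 1 , - + 1)
stepVec NW = (- + 1 , + 1)
stepVec SE = (+ 1 , - + 1)
stepVec W  = (- + 2 , + 0)
stepVec E  = (+ 2 , + 0)

opp : Step → Step
opp NE = SW
opp SW = NE
opp NW = SE
opp SE = NW
opp W  = E
opp E  = W

stepMat : Step → Mat
stepMat NE = αM
stepMat SW = inv₁ αM
stepMat NW = βM
stepMat SE = inv₁ βM
stepMat W  = γM
stepMat E  = inv₁ γM

DEdge : Set
DEdge = Vertex × Step

target : DEdge → Vertex
target (v , s) = v ⊕ stepVec s

reverseE : DEdge → DEdge
reverseE (v , s) = (target (v , s) , opp s)

ccwEdges : Hex → List DEdge
ccwEdges h =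
    (c ⊕ (+ 2 , + 0)     , NW)
  ∷ (c ⊕ (+ 1 , + 1)     , W)
  ∷ (c ⊕ (- + 1 , + 1)   , SW)
  ∷ (c ⊕ (- + 2 , + 0)   , SE)
  ∷ (c ⊕ (- + 1 , - + 1) , E)
  ∷ (c ⊕ (+ 1 , - + 1)   , NE)
  ∷ []
  where c = centre h

Region : Set
Region = List Hex

IsBoundaryEdge : Region → DEdge → Set
IsBoundaryEdge R e =
  (Σ Hex λ h → h ∈ R × e ∈ ccwEdges h) ×
  (∀ h → h ∈ R → reverseE e ∉ ccwEdges h)

IsBoundaryVertex : Region → Vertex → Set
IsBoundaryVertex R v =
  Σ DEdge λ e → IsBoundaryEdge R e × (proj₁ e ≡ v ⊎ target e ≡ v)

walkEdges : Vertex → List Step → List DEdge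
walkEdges v []       = []
walkEdges v (s ∷ ss) = (v , s) ∷ walkEdges (v ⊕ stepVec s) ss

endpoint : Vertex → List Step → Vertex
endpoint v []       = v
endpoint v (s ∷ ss) = endpoint (v ⊕ stepVec s) ss

IsCCWBoundaryTraversal : Region → Vertex → List Step → Set
IsCCWBoundaryTraversal R v ss =
  endpoint v ss ≡ v ×
  All (IsBoundaryEdge R) (walkEdges v ss) ×
  Unique (walkEdges v ss) ×
  (∀ e → IsBoundaryEdge R e → e ∈ walkEdges v ss)

-- M = M_n ⋯ M_1
walkMat : List Step → Mat
walkMat ss = foldl (λ acc s → stepMat s · acc) I₂ ss

data Tile : Set where
  bone  : Hex → Fin 6 → Tile
  snakeL : Hex → Fin 6 → Tile
  snakeR : Hex → Fin 6 → Tile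

snakeCells : Hex → Hex → Hex → List Hex
snakeCells p u w = p ∷ (p ⊕ u) ∷ ((p ⊕ u) ⊕ w) ∷ (((p ⊕ u) ⊕ u) ⊕ w) ∷ []

cells : Tile → List Hex
cells (bone p i)   = p ∷ (p ⊕ unit i) ∷ ((p ⊕ unit i) ⊕ unit i) ∷ []
cells (snakeL p i) = snakeCells p (unit i) (unit (rotL i))
cells (snakeR p i) = snakeCells p (unit i) (unit (rotR i))

signℤ : Sign → ℤ
signℤ Sign.+ = + 1
signℤ Sign.- = - + 1

WTile : Set
WTile = Tile × Sign

_≟H_ : (h h' : Hex) → Relation.Nullary.Dec (h ≡ h')
_≟H_ = ×P.≡-dec ℤP._≟_ ℤP._≟_

open import Data.List.Membership.DecPropositional _≟H_ using () renaming (_∈?_ to _∈H?_)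

coverWeight : List WTile → Hex → ℤ
coverWeight []            h = + 0
coverWeight ((t , s) ∷ T) h with h ∈H? cells t
... | yes _ = signℤ s + coverWeight T h
... | no  _ = coverWeight T h

IsSignedTiling : Region → List WTile → Set
IsSignedTiling R T =
  ∀ h → (h ∈ R → coverWeight T h ≡ + 1) × (h ∉ R → coverWeight T h ≡ + 0)

R₂₂₂ : Region
R₂₂₂ = (+ 0 , + 0) ∷
       unit zero ∷ unit (suc zero) ∷ unit (suc (suc zero)) ∷
       unit (suc (suc (suc zero))) ∷ unit (suc (suc (suc (suc zero)))) ∷
       unit (suc (suc (suc (suc (suc zero))))) ∷ []

{-# OPTIONS --safe #-}
-- The tiling is an explicit list of eight signed tiles, checked hexagon by hexagon.
-- The boundary of R₂₂₂ is a simple closed walk of 18 edges.  No vertex is left by two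
-- boundary edges, so a walk along boundary edges is determined by its start and its
-- length; a traversal lists every boundary edge exactly once, so its length is 18.
-- Hence M(R₂₂₂, v) is the product along the one closed boundary walk from v, and
-- that product is computed to be I₂ at each of the 18 boundary vertices.
module Submission where

open import Defs
open import Data.List using (List)
open import Data.Product using (Σ; _×_)
open import Relation.Binary.PropositionalEquality using (_≡_)

open import Data.Nat as ℕ using (ℕ; zero; suc)
open import Data.Integer using (+_; -[1+_])
import Data.Integer.Properties as ℤ
open import Data.Fin using (#_)
open import Data.List using ([]; _∷_; map; length; filter; concatMap)
open import Data.List.Relation.Unary.All as All using (All; []; _∷_; all?)
open import Data.List.Relation.Unary.Any using (Any; here; there; any?)
open import Data.List.Relation.Unary.Unique.Propositional using (Unique; _∷_)
import Data.List.Relation.Unary.Unique.Propositional.Properties as Uniqueₚ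
open import Data.List.Relation.Binary.BagAndSetEquality using (_∼[_]_; set; ∼bag⇒↭)
open import Data.List.Relation.Binary.Permutation.Propositional.Properties using (↭-length)
open import Data.List.Membership.Propositional using (_∈_; _∉_; find; lose)
open import Data.List.Membership.Propositional.Properties
  using (∈-map⁺; ∈-++⁺ˡ; ∈-++⁺ʳ; ∈-concatMap⁺; ∈-filter⁺; ∈-filter⁻)
open import Data.List.Membership.Propositional.Properties.WithK using (unique∧set⇒bag)
open import Data.List.Membership.DecPropositional _≟H_ using () renaming (_∈?_ to _∈H?_)
open import Data.Product using (_,_; proj₁; proj₂)
import Data.Product.Properties as ×
open import Data.Sum using (inj₁; inj₂)
open import Data.Sign using (Sign)
open import Function using (_∘_)
open import Function.Bundles using (mk⇔)
open import Relation.Nullary using (Dec; yes; no; ¬_; ¬?; contradiction)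
open import Relation.Nullary.Decidable using (map′; _×-dec_; _→-dec_; from-yes)
open import Relation.Unary using (Pred; Decidable)
open import Relation.Binary.Definitions using (DecidableEquality)
open import Relation.Binary.PropositionalEquality using (refl; sym; trans; cong; module ≡-Reasoning)

stepCode : Step → ℕ
stepCode NE = 0
stepCode SW = 1
stepCode NW = 2
stepCode SE = 3
stepCode W  = 4
stepCode E  = 5

stepOfCode : ℕ → Step
stepOfCode 0 = NE
stepOfCode 1 = SW
stepOfCode 2 = NW
stepOfCode 3 = SE
stepOfCode 4 = W
stepOfCode _ = E

stepOfCode-stepCode : ∀ s → stepOfCode (stepCode s) ≡ s
stepOfCode-stepCode NE = refl
stepOfCode-stepCode SW = refl
stepOfCode-stepCode NW = refl
stepOfCode-stepCode SE = refl
stepOfCode-stepCode W  = refl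
stepOfCode-stepCode E  = refl

stepCode-injective : ∀ {s t} → stepCode s ≡ stepCode t → s ≡ t
stepCode-injective {s} {t} eq =
  trans (sym (stepOfCode-stepCode s)) (trans (cong stepOfCode eq) (stepOfCode-stepCode t))

_≟S_ : DecidableEquality Step
s ≟S t = map′ stepCode-injective (cong stepCode) (stepCode s ℕ.≟ stepCode t)

_≟P_ : DecidableEquality Point
_≟P_ = ×.≡-dec ℤ._≟_ ℤ._≟_

_≟E_ : DecidableEquality DEdge
_≟E_ = ×.≡-dec _≟P_ _≟S_

_≟ω_ : DecidableEquality ℤω
mkE a b c d ≟ω mkE a′ b′ c′ d′ =
  map′ (λ { (refl , refl , refl , refl) → refl }) (λ { refl → refl , refl , refl , refl })
       (a ℤ.≟ a′ ×-dec b ℤ.≟ b′ ×-dec c ℤ.≟ c′ ×-dec d ℤ.≟ d′)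

_≟M_ : DecidableEquality Mat
mat a b c d ≟M mat a′ b′ c′ d′ =
  map′ (λ { (refl , refl , refl , refl) → refl }) (λ { refl → refl , refl , refl , refl })
       (a ≟ω a′ ×-dec b ≟ω b′ ×-dec c ≟ω c′ ×-dec d ≟ω d′)

open import Data.List.Membership.DecPropositional _≟E_ using () renaming (_∈?_ to _∈E?_)
open import Data.List.Relation.Unary.Unique.DecPropositional _≟E_ using (unique?)
open import Data.List.Membership.DecPropositional _≟P_ using () renaming (_∈?_ to _∈P?_)
open import Data.List.Relation.Unary.Unique.DecPropositional _≟P_ using () renaming (unique? to uniqueP?)

cellsOf : List WTile → List Hex
cellsOf = concatMap (cells ∘ proj₁)

coverWeight-outside : ∀ T {h} → h ∉ cellsOf T → coverWeight T h ≡ + 0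
coverWeight-outside []            h∉ = refl
coverWeight-outside ((t , s) ∷ T) {h} h∉ with h ∈H? cells t
... | yes h∈t = contradiction (∈-++⁺ˡ h∈t) h∉
... | no  _   = coverWeight-outside T (h∉ ∘ ∈-++⁺ʳ (cells t))

isSignedTiling? : ∀ R T → Dec (IsSignedTiling R T)
isSignedTiling? R T = map′ to from
  (all? (λ h → coverWeight T h ℤ.≟ + 1) R ×-dec
   all? (λ h → ¬? (h ∈H? R) →-dec coverWeight T h ℤ.≟ + 0) (cellsOf T))
  where
  to : All (λ h → coverWeight T h ≡ + 1) R × All (λ h → h ∉ R → coverWeight T h ≡ + 0) (cellsOf T) →
       IsSignedTiling R T
  to (inside , outside) h = All.lookup inside , weightOutside (h ∈H? cellsOf T)
    where
    weightOutside : Dec (h ∈ cellsOf T) → h ∉ R → coverWeight T h ≡ + 0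
    weightOutside (yes h∈T) = All.lookup outside h∈T
    weightOutside (no  h∉T) _ = coverWeight-outside T h∉T

  from : IsSignedTiling R T →
         All (λ h → coverWeight T h ≡ + 1) R × All (λ h → h ∉ R → coverWeight T h ≡ + 0) (cellsOf T)
  from tiles = All.tabulate (λ {h} → proj₁ (tiles h)) , All.tabulate (λ {h} _ → proj₂ (tiles h))

walkEdges-length : ∀ v ss → length (walkEdges v ss) ≡ length ss
walkEdges-length v []       = refl
walkEdges-length v (s ∷ ss) = cong suc (walkEdges-length (v ⊕ stepVec s) ss)

follow : (Vertex → Step) → Vertex → ℕ → List Step
follow next v zero    = []
follow next v (suc k) = next v ∷ follow next (v ⊕ stepVec (next v)) k

walk-forced : ∀ {p} {P : Pred DEdge p} (next : Vertex → Step) →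
              (∀ {u s} → P (u , s) → s ≡ next u) →
              ∀ v ss → All P (walkEdges v ss) → ss ≡ follow next v (length ss)
walk-forced next deterministic v []       []       = refl
walk-forced next deterministic v (s ∷ ss) (p ∷ ps) with deterministic p
... | refl = cong (next v ∷_) (walk-forced next deterministic (v ⊕ stepVec s) ss ps)

outStep : List DEdge → Vertex → Step
outStep []             u = NE  -- junk value: only vertices left by an edge of the list are queried
outStep ((w , s) ∷ es) u with u ≟P w
... | yes _ = s
... | no  _ = outStep es u

outStep-unique : ∀ {es u s} → Unique (map proj₁ es) → (u , s) ∈ es → outStep es u ≡ s
outStep-unique {(w , t) ∷ es} {u} _ (here refl) with u ≟P u
... | yes _  = refl
... | no u≢u = contradiction refl u≢u
outStep-unique {(w , t) ∷ es} {u} unique@(_ ∷ unique′) (there e∈es) with u ≟P w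
... | yes refl = contradiction (∈-map⁺ proj₁ e∈es) (Uniqueₚ.Unique[x∷xs]⇒x∉xs unique)
... | no  _    = outStep-unique unique′ e∈es

isBoundaryEdge? : ∀ R → Decidable (IsBoundaryEdge R)
isBoundaryEdge? R e = map′ to from
  (any? (λ h → e ∈E? ccwEdges h) R ×-dec ¬? (any? (λ h → reverseE e ∈E? ccwEdges h) R))
  where
  to : Any (λ h → e ∈ ccwEdges h) R × ¬ Any (λ h → reverseE e ∈ ccwEdges h) R → IsBoundaryEdge R e
  to (onR , notShared) = find onR , λ h h∈R r → notShared (lose h∈R r)

  from : IsBoundaryEdge R e → Any (λ h → e ∈ ccwEdges h) R × ¬ Any (λ h → reverseE e ∈ ccwEdges h) R
  from ((h , h∈R , e∈h) , notShared) =
    lose h∈R e∈h , λ shared → let (h′ , h′∈R , r) = find shared in notShared h′ h′∈R r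

boundaryEdges : Region → List DEdge
boundaryEdges R = filter (isBoundaryEdge? R) (concatMap ccwEdges R)

boundaryVertices : Region → List Vertex
boundaryVertices R = map proj₁ (boundaryEdges R)

boundaryEdges-sound : ∀ {R e} → e ∈ boundaryEdges R → IsBoundaryEdge R e
boundaryEdges-sound {R} = proj₂ ∘ ∈-filter⁻ (isBoundaryEdge? R) {xs = concatMap ccwEdges R}

boundaryEdges-complete : ∀ {R e} → IsBoundaryEdge R e → e ∈ boundaryEdges R
boundaryEdges-complete {R} be@((h , h∈R , e∈h) , _) =
  ∈-filter⁺ (isBoundaryEdge? R) (∈-concatMap⁺ ccwEdges (lose h∈R e∈h)) be

boundaryVertex⇒∈boundaryVertices : ∀ {R v} →
  All (λ e → target e ∈ boundaryVertices R) (boundaryEdges R) →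
  IsBoundaryVertex R v → v ∈ boundaryVertices R
boundaryVertex⇒∈boundaryVertices _      (e , be , inj₁ refl) = ∈-map⁺ proj₁ (boundaryEdges-complete be)
boundaryVertex⇒∈boundaryVertices closed (e , be , inj₂ refl) = All.lookup closed (boundaryEdges-complete be)

isCCWBoundaryTraversal? : ∀ R v ss → Dec (IsCCWBoundaryTraversal R v ss)
isCCWBoundaryTraversal? R v ss =
  endpoint v ss ≟P v ×-dec all? (isBoundaryEdge? R) es ×-dec unique? es ×-dec
  map′ (λ covered e → All.lookup covered ∘ boundaryEdges-complete)
       (λ covers → All.tabulate (λ e∈B → covers _ (boundaryEdges-sound e∈B)))
       (all? (_∈E? es) (boundaryEdges R))
  where es = walkEdges v ss

traversal-length : ∀ {R v ss} → Unique (boundaryEdges R) →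
                   IsCCWBoundaryTraversal R v ss → length ss ≡ length (boundaryEdges R)
traversal-length {R} {v} {ss} uniqueB (_ , onBoundary , uniqueW , covers) = begin
  length ss                ≡⟨ walkEdges-length v ss ⟨
  length (walkEdges v ss)  ≡⟨ ↭-length (∼bag⇒↭ (unique∧set⇒bag uniqueW uniqueB sameEdges)) ⟩
  length (boundaryEdges R) ∎
  where
  open ≡-Reasoning
  sameEdges : walkEdges v ss ∼[ set ] boundaryEdges R
  sameEdges = mk⇔ (boundaryEdges-complete ∘ All.lookup onBoundary)
                  (covers _ ∘ boundaryEdges-sound)

boundaryTour : Region → Vertex → List Step
boundaryTour R v = follow (outStep (boundaryEdges R)) v (length (boundaryEdges R))

traversal-forced : ∀ {R v ss} → Unique (boundaryVertices R) →
                   IsCCWBoundaryTraversal R v ss → ss ≡ boundaryTour R v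
traversal-forced {R} {v} {ss} simple traversal@(_ , onBoundary , _) = begin
  ss                        ≡⟨ walk-forced next (sym ∘ outStep-unique simple) v ss
                                 (All.map boundaryEdges-complete onBoundary) ⟩
  follow next v (length ss) ≡⟨ cong (follow next v) (traversal-length (Uniqueₚ.map⁻ simple) traversal) ⟩
  boundaryTour R v          ∎
  where
  open ≡-Reasoning
  next : Vertex → Step
  next = outStep (boundaryEdges R)

tiling₂₂₂ : List WTile
tiling₂₂₂ =
  (bone   (-[1+ 1 ] , + 0)      (# 5) , Sign.-) ∷
  (bone   (-[1+ 1 ] , + 1)      (# 5) , Sign.-) ∷
  (bone   (-[1+ 0 ] , -[1+ 0 ]) (# 0) , Sign.+) ∷
  (bone   (-[1+ 0 ] , + 2)      (# 5) , Sign.+) ∷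
  (bone   (+ 0 , -[1+ 1 ])      (# 1) , Sign.+) ∷
  (snakeL (-[1+ 1 ] , + 0)      (# 0) , Sign.+) ∷
  (snakeL (-[1+ 1 ] , + 1)      (# 5) , Sign.+) ∷
  (snakeR (-[1+ 0 ] , + 2)      (# 5) , Sign.-) ∷
  []

tiling₂₂₂-signed : IsSignedTiling R₂₂₂ tiling₂₂₂
tiling₂₂₂-signed = from-yes (isSignedTiling? R₂₂₂ tiling₂₂₂)

boundary₂₂₂-simple : Unique (boundaryVertices R₂₂₂)
boundary₂₂₂-simple = from-yes (uniqueP? (boundaryVertices R₂₂₂))

boundary₂₂₂-closed : All (λ e → target e ∈ boundaryVertices R₂₂₂) (boundaryEdges R₂₂₂)
boundary₂₂₂-closed = from-yes (all? (λ e → target e ∈P? boundaryVertices R₂₂₂) (boundaryEdges R₂₂₂))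

boundaryTour₂₂₂-spec : All (λ v → IsCCWBoundaryTraversal R₂₂₂ v (boundaryTour R₂₂₂ v) ×
                                  walkMat (boundaryTour R₂₂₂ v) ≡ I₂)
                           (boundaryVertices R₂₂₂)
boundaryTour₂₂₂-spec = from-yes (all? (λ v → isCCWBoundaryTraversal? R₂₂₂ v (boundaryTour R₂₂₂ v) ×-dec
                                             walkMat (boundaryTour R₂₂₂ v) ≟M I₂)
                                      (boundaryVertices R₂₂₂))

mainTheorem6 : Σ (List WTile) (λ T → IsSignedTiling R₂₂₂ T) ×
    (∀ v → IsBoundaryVertex R₂₂₂ v →
      Σ (List Step) (λ ss → IsCCWBoundaryTraversal R₂₂₂ v ss) ×
      (∀ ss → IsCCWBoundaryTraversal R₂₂₂ v ss → walkMat ss ≡ I₂))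
mainTheorem6 = (tiling₂₂₂ , tiling₂₂₂-signed) , λ v onBoundary →
  let (traversal , trivialHolonomy) =
        All.lookup boundaryTour₂₂₂-spec (boundaryVertex⇒∈boundaryVertices boundary₂₂₂-closed onBoundary)
  in (boundaryTour R₂₂₂ v , traversal) ,
     λ ss traversal′ → trans (cong walkMat (traversal-forced boundary₂₂₂-simple traversal′)) trivialHolonomy
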